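{- For positive integers $n$ and $r$ with $r \geq 2$, let $A,B,A',B'$ be elements of $F_r(n)$ with $A \neq B$. (i) If $A' \neq B$ and $A \leq_r A'$, then $\gamma(A,B) \geq_{r-1} \gamma(A',B)$. (ii) If $A \neq B'$ and $B \leq_r B'$, then $\gamma(A,B) \leq_{r-1} \gamma(A,B')$.
   Context: Fix a positive integer $n$. Level 1: $F_1(n)=\{ -,+\}$ with $F_1^-(n)=\{ -\}$, $F_1^+(n)=\{+\}$, $-<_1+$, $-\equiv_1+$. Level 2: $F_2^-(n)=\{(2n-i+1,i): i\in[n]\}$, $F_2^+(n)=\{(i,2n-i+1): i\in[n]\}$, $F_2(n)=F_2^-(n)\cup F_2^+(n)$, ordered $(2n,1)<_2(2n-1,2)<_2\dots<_2(1,2n)$, with $(2n-i+1,i)\equiv_2(i,2n-i+1)$. For $r\ge2$, each $\equiv_r$-class contains exactly one element of $F_r^-(n)$; for $A\in F_r(n)$ let $A^-$ be that element, and define $A\preceq_r B$ iff $A^-\le_r B^-$, $A\prec_r B$ iff $A^-<_r B^-$. For distinct $A=(a_1,a_2),B=(b_1,b_2)\in F_2(n)$, $\gamma(A,B)=-$ if $a_1<b_1$ and $+$ if $a_1>b_1$. For $r\ge3$: $F_r(n)$ is the family of sets $X\subseteq F_{r-1}(n)$ containing exactly one element of each $\equiv_{r-1}$-class; $F_r^-(n)$ ($F_r^+(n)$) consists of those containing the $<_{r-1}$-minimum (maximum) of $F_{r-1}(n)$. For distinct $A,B\in F_r(n)$, $\gamma(A,B)$ is the element of $B\cap E$, where $E$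 is the $\prec_{r-1}$-first $\equiv_{r-1}$-class on which $A,B$ differ; the total order $<_r$ is given by $A<_rB$ iff $\gamma(A,B)\in F_{r-1}^+(n)$, and $\le_r$, $\ge_r$ are its reflexive versions. For $X\in F_r^-(n)$, $\sigma_r(X)$ replaces each element of $X$ by the other element of its $\equiv_{r-1}$-class; $A\equiv_rB$ iff $A=B$, $A=\sigma_r(B)$ or $B=\sigma_r(A)$. -}

module Defs where

open import Data.Nat using (ℕ; pred; zero; suc; _+_; _*_; _∸_; _≤_; _<_)
open import Data.Bool using (Bool; true; false)
open import Data.Fin using (Fin)
open import Data.List using (List; []; _∷_; length; concatMap; map; upTo)
import Data.List as List
open import Data.Vec using (Vec)
import Data.Vec as Vec
open import Data.Product using (Σ; Σ-syntax; _×_; _,_)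
open import Data.Sum using (_⊎_)
open import Data.Empty using (⊥)
open import Data.Unit using (⊤)
open import Relation.Nullary using (¬_)
open import Relation.Binary.PropositionalEquality using (_≡_; _≢_)
open import Function.Bundles using (_⇔_)

data Sign : Set where
  minus plus : Sign

-- A "level" bundles the data of F_r(n):
--   Car   : a raw carrier type containing F_r(n)
--   elems : a duplicate-free list of raw elements containing all of F_r(n)
--           (used to represent subsets of F_r(n) as bit vectors)
--   InF, InF⁻, InF⁺ : membership in F_r(n), F_r^-(n), F_r^+(n)
--   _<ᵣ_  : the strict total order <_r
--   _≡r_  : the equivalence ≡_r

record Level : Set₁ where
  field
    Car   : Set
    elems : List Car
    InF   : Car → Set
    InF⁻  : Car → Set
    InF⁺  : Car → Set
    _<ᵣ_  : Car → Car → Set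
    _≡r_  : Car → Car → Set

module Derived (L : Level) where
  open Level L

  _≤ᵣ_ : Car → Car → Set
  x ≤ᵣ y = x ≡ y ⊎ x <ᵣ y

  IsMin : Car → Set
  IsMin m = InF m × (∀ y → InF y → m ≤ᵣ y)

  IsMax : Car → Set
  IsMax m = InF m × (∀ y → InF y → y ≤ᵣ m)

  IsMinusOf : Car → Car → Set
  IsMinusOf x m = InF⁻ m × (x ≡r m)

  _⪯_ : Car → Car → Set
  x ⪯ y = Σ[ mx ∈ Car ] Σ[ my ∈ Car ] (IsMinusOf x mx × IsMinusOf y my × mx ≤ᵣ my)

level1 : Level
level1 = record
  { Car   = Sign
  ; elems = minus ∷ plus ∷ []
  ; InF   = λ _ → ⊤
  ; InF⁻  = λ x → x ≡ minus
  ; InF⁺  = λ x → x ≡ plus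
  ; _<ᵣ_  = λ x y → x ≡ minus × y ≡ plus
  ; _≡r_  = λ _ _ → ⊤
  }

module Level2 (n : ℕ) where
  Car2 : Set
  Car2 = ℕ × ℕ

  lowPair : ℕ → Car2
  lowPair i = ((2 * n ∸ i) + 1 , i)

  highPair : ℕ → Car2
  highPair i = (i , (2 * n ∸ i) + 1)

  InF2⁻ : Car2 → Set
  InF2⁻ A = Σ[ i ∈ ℕ ] (1 ≤ i × i ≤ n × A ≡ lowPair i)

  InF2⁺ : Car2 → Set
  InF2⁺ A = Σ[ i ∈ ℕ ] (1 ≤ i × i ≤ n × A ≡ highPair i)

  -- (2n,1) <₂ (2n-1,2) <₂ … <₂ (1,2n): ordered by decreasing first coordinate
  Lt2 : Car2 → Car2 → Set
  Lt2 (a₁ , _) (b₁ , _) = b₁ < a₁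

  Eq2 : Car2 → Car2 → Set
  Eq2 A B = A ≡ B
          ⊎ (Σ[ i ∈ ℕ ] (1 ≤ i × i ≤ n × A ≡ lowPair i × B ≡ highPair i))
          ⊎ (Σ[ i ∈ ℕ ] (1 ≤ i × i ≤ n × A ≡ highPair i × B ≡ lowPair i))

  elems2 : List Car2
  elems2 = concatMap (λ i → map (λ j → (i , j)) (upTo (suc (2 * n)))) (upTo (suc (2 * n)))

  Gamma2 : Car2 → Car2 → Sign → Set
  Gamma2 (a₁ , _) (b₁ , _) s = (a₁ < b₁ × s ≡ minus) ⊎ (b₁ < a₁ × s ≡ plus)

level2 : ℕ → Level
level2 n = record
  { Car   = Car2
  ; elems = elems2
  ; InF   = λ A → InF2⁻ A ⊎ InF2⁺ A
  ; InF⁻  = InF2⁻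
  ; InF⁺  = InF2⁺
  ; _<ᵣ_  = Lt2
  ; _≡r_  = Eq2
  }
  where open Level2 n

-- Level r ≥ 3 from level r-1 (= L).  Subsets of the carrier of L are
-- represented as bit vectors indexed by the enumeration  elems L.

allVecs : (m : ℕ) → List (Vec Bool m)
allVecs zero    = Vec.[] ∷ []
allVecs (suc m) = concatMap (λ v → (true Vec.∷ v) ∷ (false Vec.∷ v) ∷ []) (allVecs m)

module Step (L : Level) where
  open Level L
  open Derived L

  SCar : Set
  SCar = Vec Bool (length elems)

  Mem : Car → SCar → Set
  Mem x X = Σ[ i ∈ Fin (length elems) ] (List.lookup elems i ≡ x × Vec.lookup X i ≡ true)

  SInF : SCar → Set
  SInF X = (∀ x → Mem x X → InF x)
         × (∀ x → InF x →
              Σ[ y ∈ Car ] ((Mem y X × x ≡r y) × (∀ z → Mem z X → x ≡r z → z ≡ y)))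

  SInF⁻ : SCar → Set
  SInF⁻ X = SInF X × Σ[ m ∈ Car ] (IsMin m × Mem m X)

  SInF⁺ : SCar → Set
  SInF⁺ X = SInF X × Σ[ m ∈ Car ] (IsMax m × Mem m X)

  IsSigma : SCar → SCar → Set
  IsSigma X Y = SInF⁻ X × (∀ y → Mem y Y ⇔ (Σ[ x ∈ Car ] (Mem x X × x ≡r y × x ≢ y)))

  SEq : SCar → SCar → Set
  SEq A B = A ≡ B ⊎ IsSigma B A ⊎ IsSigma A B

  DiffOn : SCar → SCar → Car → Set
  DiffOn A B x = Σ[ y ∈ Car ] (x ≡r y × ¬ (Mem y A ⇔ Mem y B))

  SGamma : SCar → SCar → Car → Set
  SGamma A B C = Mem C B × InF C × DiffOn A B C
               × (∀ y → InF y → DiffOn A B y → C ⪯ y)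

  SLt : SCar → SCar → Set
  SLt A B = Σ[ C ∈ Car ] (SGamma A B C × InF⁺ C)

step : Level → Level
step L = record
  { Car   = SCar
  ; elems = allVecs (length (Level.elems L))
  ; InF   = SInF
  ; InF⁻  = SInF⁻
  ; InF⁺  = SInF⁺
  ; _<ᵣ_  = SLt
  ; _≡r_  = SEq
  }
  where open Step L

-- The levels: lvl n r is F_r(n)  (r = 0 is a junk copy of level 1)

lvl : ℕ → ℕ → Level
lvl n zero                   = level1
lvl n (suc zero)             = level1
lvl n (suc (suc zero))       = level2 n
lvl n (suc (suc (suc k)))    = step (lvl n (suc (suc k)))

Car : ℕ → ℕ → Set
Car n r = Level.Car (lvl n r)

F : (n r : ℕ) → Car n r → Set
F n r = Level.InF (lvl n r)


Le : (n r : ℕ) → Car n r → Car n r → Set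
Le n r = Derived._≤ᵣ_ (lvl n r)

Gamma : (n r : ℕ) → Car n r → Car n r → Car n (pred r) → Set
Gamma n zero                _ _ _ = ⊥
Gamma n (suc zero)          _ _ _ = ⊥
Gamma n (suc (suc zero))    A B C = Level2.Gamma2 n A B C
Gamma n (suc (suc (suc k))) A B C = Step.SGamma (lvl n (suc (suc k))) A B C

module Submission where

-- Call a level regular when F_r(n) is order-isomorphic to a chain of classes
-- Fin k, each split into a - and a + element, under the nested order: the
-- (i,-) increase with i, lie below every (j,+), and the (j,+) decrease with
-- j; F_r^±(n) are the elements of sign ± and ≡_r identifies the two elements
-- of a class.  Over a regular level, an element X of the next level is
-- determined by its sign function (class i ↦ sign of the element X picks in
-- class i); γ(A,B) is then the first class where the sign functions of A and
-- B differ, carrying the sign of B there, and <_r is lexicographic order.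
--
-- Lemma 3.3 follows: directly at r = 2, and from the
-- regularity of level r-1 for r ≥ 3.

open import Defs
open import Data.Nat as ℕ using (ℕ; zero; suc; _+_; _*_; _∸_; _^_; _⊓_; _≤_; pred; z≤n; s≤s)
import Data.Nat.Properties as ℕP
open import Data.Bool as Bool using (Bool; true; false)
open import Data.Fin as Fin using (Fin; toℕ)
import Data.Fin.Properties as FinP
open import Data.List as List using (List; []; _∷_; length; concatMap; map; upTo)
open import Data.List.Relation.Unary.Any using (here; there)
import Data.List.Relation.Unary.Any as Any
import Data.List.Relation.Unary.Any.Properties as AnyP
open import Data.List.Relation.Unary.All as All using (All; []; _∷_)
open import Data.List.Relation.Unary.AllPairs using ([]; _∷_)
open import Data.List.Relation.Unary.Unique.Propositional using (Unique)
import Data.List.Relation.Unary.Unique.Propositional.Properties as UniqueP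
open import Data.List.Membership.Propositional using (_∈_)
open import Data.List.Membership.Propositional.Properties
  using (∈-lookup; ∈-upTo⁺; ∈-cartesianProduct⁺)
open import Data.Vec as Vec using (Vec; []; _∷_; tabulate)
import Data.Vec.Properties as VecP
open import Data.Product using (Σ; _×_; _,_; proj₁; proj₂)
import Data.Product.Properties as ProductP
open import Data.Sum using (_⊎_; inj₁; inj₂)
open import Data.Empty using (⊥; ⊥-elim)
open import Relation.Nullary using (¬_; Dec; yes; no; does)
open import Relation.Nullary.Decidable using (dec-true; dec-false; does-⇔; _×-dec_)
open import Relation.Binary.PropositionalEquality
open import Relation.Binary.Definitions using (tri<; tri≈; tri>)
open import Function.Bundles using (mk⇔; Equivalence)
open import Function using (_∘_)

open Equivalence

-- Signs.  Sign has exactly two elements; flipping a sign is what σ_r does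
-- to each coordinate of an element of F_r^-(n).

flipSign : Sign → Sign
flipSign minus = plus
flipSign plus  = minus

flipSign-involutive : ∀ s → flipSign (flipSign s) ≡ s
flipSign-involutive minus = refl
flipSign-involutive plus  = refl

flipSign-≢ : ∀ s → flipSign s ≢ s
flipSign-≢ minus ()
flipSign-≢ plus  ()

minus≢plus : minus ≢ plus
minus≢plus ()

≢plus⇒minus : ∀ {s} → s ≢ plus → s ≡ minus
≢plus⇒minus {minus} _ = refl
≢plus⇒minus {plus}  p = ⊥-elim (p refl)

≢minus⇒plus : ∀ {s} → s ≢ minus → s ≡ plus
≢minus⇒plus {plus}  _ = refl
≢minus⇒plus {minus} p = ⊥-elim (p refl)

≢⇒flipSign : ∀ {s t} → s ≢ t → s ≡ flipSign t
≢⇒flipSign {minus} {plus}  _ = refl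
≢⇒flipSign {plus}  {minus} _ = refl
≢⇒flipSign {minus} {minus} p = ⊥-elim (p refl)
≢⇒flipSign {plus}  {plus}  p = ⊥-elim (p refl)

two-signs : ∀ {s t u : Sign} → s ≢ t → t ≢ u → s ≡ u
two-signs {minus} {plus}  {minus} _ _ = refl
two-signs {plus}  {minus} {plus}  _ _ = refl
two-signs {minus} {minus} p _ = ⊥-elim (p refl)
two-signs {plus}  {plus}  p _ = ⊥-elim (p refl)
two-signs {minus} {plus}  {plus}  _ q = ⊥-elim (q refl)
two-signs {plus}  {minus} {minus} _ q = ⊥-elim (q refl)

_≟Sign_ : (s t : Sign) → Dec (s ≡ t)
minus ≟Sign minus = yes refl
minus ≟Sign plus  = no λ ()
plus  ≟Sign minus = no λ ()
plus  ≟Sign plus  = yes refl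

-- This
-- is the shape of (2n,1) <₂ (2n-1,2) <₂ … <₂ (1,2n) with classes indexed
-- by i, and (as shown below) the shape of every level F_r(n).

NestedLt : ∀ {k} → Fin k → Sign → Fin k → Sign → Set
NestedLt i s j t = (toℕ i ℕ.< toℕ j × s ≡ minus)
                 ⊎ (toℕ j ℕ.< toℕ i × t ≡ plus)
                 ⊎ (i ≡ j × s ≡ minus × t ≡ plus)

NestedLe : ∀ {k} → Fin k → Sign → Fin k → Sign → Set
NestedLe i s j t = (i ≡ j × s ≡ t) ⊎ NestedLt i s j t

-- Trichotomy; it lets an order embedding into the nested order be inverted.
nested-trichotomy : ∀ {k} (i : Fin k) s j t →
                    NestedLt i s j t ⊎ (i ≡ j × s ≡ t) ⊎ NestedLt j t i s
nested-trichotomy i s j t with FinP.<-cmp i j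
nested-trichotomy i minus j t     | tri< lt _ _ = inj₁ (inj₁ (lt , refl))
nested-trichotomy i plus  j t     | tri< lt _ _ = inj₂ (inj₂ (inj₂ (inj₁ (lt , refl))))
nested-trichotomy i s     j plus  | tri> _ _ gt = inj₁ (inj₂ (inj₁ (gt , refl)))
nested-trichotomy i s     j minus | tri> _ _ gt = inj₂ (inj₂ (inj₁ (gt , refl)))
nested-trichotomy i minus .i minus | tri≈ _ refl _ = inj₂ (inj₁ (refl , refl))
nested-trichotomy i plus  .i plus  | tri≈ _ refl _ = inj₂ (inj₁ (refl , refl))
nested-trichotomy i minus .i plus  | tri≈ _ refl _ = inj₁ (inj₂ (inj₂ (refl , refl , refl)))
nested-trichotomy i plus  .i minus | tri≈ _ refl _ = inj₂ (inj₂ (inj₂ (inj₂ (refl , refl , refl))))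

module _ {k : ℕ} where

  FirstDiff : (f g : Fin k → Sign) → Fin k → Set
  FirstDiff f g i = f i ≢ g i × (∀ j → f j ≢ g j → toℕ i ≤ toℕ j)

  LexLt : (f g : Fin k → Sign) → Set
  LexLt f g = Σ (Fin k) λ d → FirstDiff f g d × g d ≡ plus

  LexLe : (f g : Fin k → Sign) → Set
  LexLe f g = (∀ j → f j ≡ g j) ⊎ LexLt f g

  agree-before : ∀ {f g i j} → FirstDiff f g i → toℕ j ℕ.< toℕ i → f j ≡ g j
  agree-before {f} {g} {i} {j} (_ , first) j<i with f j ≟Sign g j
  ... | yes e = e
  ... | no  n = ⊥-elim (ℕP.<⇒≱ j<i (first j n))

  firstDiff-intro : ∀ {f g i} → f i ≢ g i → (∀ j → toℕ j ℕ.< toℕ i → f j ≡ g j) →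
                    FirstDiff f g i
  firstDiff-intro {f} {g} {i} fi≢gi agree = fi≢gi , first
    where
    first : ∀ j → f j ≢ g j → toℕ i ≤ toℕ j
    first j fj≢gj with toℕ i ℕ.≤? toℕ j
    ... | yes i≤j = i≤j
    ... | no  i≰j = ⊥-elim (fj≢gj (agree j (ℕP.≰⇒> i≰j)))

  firstDiff-unique : ∀ {f g i i'} → FirstDiff f g i → FirstDiff f g i' → i ≡ i'
  firstDiff-unique (≢i , first) (≢i' , first') =
    FinP.toℕ-injective (ℕP.≤-antisym (first _ ≢i') (first' _ ≢i))

  firstDiff-cong : ∀ {f g f' g' i} → (∀ j → f j ≡ f' j) → (∀ j → g j ≡ g' j) →
                   FirstDiff f g i → FirstDiff f' g' i
  firstDiff-cong {i = i} f≗f' g≗g' (≢i , first) =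
      (λ e → ≢i (trans (f≗f' i) (trans e (sym (g≗g' i)))))
    , λ j ≢j → first j (λ e → ≢j (trans (sym (f≗f' j)) (trans e (g≗g' j))))

  -- Let d be the first difference of f and f' (so f d = -, f' d = +)
  -- and i, i' the first differences of f, f' with g.
  firstDiff-antitoneˡ : ∀ {f f' g i i'} → FirstDiff f g i → FirstDiff f' g i' →
                        LexLe f f' → NestedLe i' (g i') i (g i)
  firstDiff-antitoneˡ {g = g} diff diff' (inj₁ f≗f') =
    let i≡i' = firstDiff-unique (firstDiff-cong f≗f' (λ _ → refl) diff) diff'
    in inj₁ (sym i≡i' , cong g (sym i≡i'))
  firstDiff-antitoneˡ {f} {f'} {g} {i} {i'} diff diff' (inj₂ (d , diffd , f'd)) with FinP.<-cmp d i
  -- d < i: f' first leaves g at d, with g d = f d = -.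
  ... | tri< d<i _ _ = at-d (firstDiff-unique diff' diff'-at-d)
    where
    fd≡gd : f d ≡ g d
    fd≡gd = agree-before diff d<i
    diff'-at-d : FirstDiff f' g d
    diff'-at-d = firstDiff-intro (λ e → proj₁ diffd (trans fd≡gd (sym e)))
      (λ j j<d → trans (sym (agree-before diffd j<d)) (agree-before diff (ℕP.<-trans j<d d<i)))
    at-d : i' ≡ d → NestedLe i' (g i') i (g i)
    at-d refl = inj₂ (inj₁ (d<i , trans (sym fd≡gd) (≢plus⇒minus (λ e → proj₁ diffd (trans e (sym f'd))))))
  -- d = i: f' agrees with g at i, hence leaves g later, and g i = f' i = +.
  ... | tri≈ _ refl _ = compare (FinP.<-cmp i' i)
    where
    f'i≡gi : f' i ≡ g i
    f'i≡gi = two-signs (λ e → proj₁ diffd (sym e)) (proj₁ diff)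
    compare : _ → NestedLe i' (g i') i (g i)
    compare (tri< i'<i _ _) =
      ⊥-elim (proj₁ diff' (trans (sym (agree-before diffd i'<i)) (agree-before diff i'<i)))
    compare (tri≈ _ refl _) = ⊥-elim (proj₁ diff' f'i≡gi)
    compare (tri> _ _ i<i') = inj₂ (inj₂ (inj₁ (i<i' , trans (sym f'i≡gi) f'd)))
  -- d > i: f' agrees with f up to i, so both leave g at i.
  ... | tri> _ _ i<d = inj₁ (sym i≡i' , cong g (sym i≡i'))
    where
    diff'-at-i : FirstDiff f' g i
    diff'-at-i = firstDiff-intro (λ e → proj₁ diff (trans (agree-before diffd i<d) e))
      (λ j j<i → trans (sym (agree-before diffd (ℕP.<-trans j<i i<d))) (agree-before diff j<i))
    i≡i' = firstDiff-unique diff'-at-i diff'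

  -- Let d be the first difference of g and g' (so g d = -, g' d = +).
  firstDiff-monotoneʳ : ∀ {f g g' i i'} → FirstDiff f g i → FirstDiff f g' i' →
                        LexLe g g' → NestedLe i (g i) i' (g' i')
  firstDiff-monotoneʳ {g' = g'} diff diff' (inj₁ g≗g') =
    let i≡i' = firstDiff-unique (firstDiff-cong (λ _ → refl) g≗g' diff) diff'
    in inj₁ (i≡i' , trans (g≗g' _) (cong g' i≡i'))
  firstDiff-monotoneʳ {f} {g} {g'} {i} {i'} diff diff' (inj₂ (d , diffd , g'd)) with FinP.<-cmp d i
  -- d < i: g' first leaves f at d, with g' d = +.
  ... | tri< d<i _ _ = at-d (firstDiff-unique diff' diff'-at-d)
    where
    fd≡gd : f d ≡ g d
    fd≡gd = agree-before diff d<i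
    diff'-at-d : FirstDiff f g' d
    diff'-at-d = firstDiff-intro (λ e → proj₁ diffd (trans (sym fd≡gd) e))
      (λ j j<d → trans (agree-before diff (ℕP.<-trans j<d d<i)) (agree-before diffd j<d))
    at-d : i' ≡ d → NestedLe i (g i) i' (g' i')
    at-d refl = inj₂ (inj₂ (inj₁ (d<i , g'd)))
  -- d = i: g' agrees with f at i, hence leaves f later, and g i = -.
  ... | tri≈ _ refl _ = compare (FinP.<-cmp i' i)
    where
    fi≡g'i : f i ≡ g' i
    fi≡g'i = two-signs (proj₁ diff) (proj₁ diffd)
    compare : _ → NestedLe i (g i) i' (g' i')
    compare (tri< i'<i _ _) =
      ⊥-elim (proj₁ diff' (trans (agree-before diff i'<i) (agree-before diffd i'<i)))
    compare (tri≈ _ refl _) = ⊥-elim (proj₁ diff' fi≡g'i)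
    compare (tri> _ _ i<i') = inj₂ (inj₁ (i<i' , ≢plus⇒minus (λ e → proj₁ diffd (trans e (sym g'd)))))
  -- d > i: g' agrees with g up to i, so f leaves both at i.
  ... | tri> _ _ i<d = inj₁ (i≡i' , trans gi≡g'i (cong g' i≡i'))
    where
    gi≡g'i : g i ≡ g' i
    gi≡g'i = agree-before diffd i<d
    diff'-at-i : FirstDiff f g' i
    diff'-at-i = firstDiff-intro (λ e → proj₁ diff (trans e (sym gi≡g'i)))
      (λ j j<i → trans (agree-before diff j<i) (agree-before diffd (ℕP.<-trans j<i i<d)))
    i≡i' = firstDiff-unique diff'-at-i diff'

-- Besides, the enumeration `elems` lists F_r(n) without repetition (needed to
-- build subsets as bit vectors) and equality of raw elements is decidable.

record Regular (L : Level) : Set where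
  open Level L renaming (Car to LCar)
  field
    k₀          : ℕ
    cls         : LCar → Fin (suc k₀)
    sgn         : LCar → Sign
    elt         : Fin (suc k₀) → Sign → LCar
    _≟_         : (x y : LCar) → Dec (x ≡ y)
    elt-F       : ∀ i s → InF (elt i s)
    cls-elt     : ∀ i s → cls (elt i s) ≡ i
    sgn-elt     : ∀ i s → sgn (elt i s) ≡ s
    elt-cls-sgn : ∀ x → InF x → elt (cls x) (sgn x) ≡ x
    F⁻⇒minus    : ∀ x → InF⁻ x → InF x × sgn x ≡ minus
    elt-F⁻      : ∀ i → InF⁻ (elt i minus)
    F⁺⇒plus     : ∀ x → InF⁺ x → InF x × sgn x ≡ plus
    elt-F⁺      : ∀ i → InF⁺ (elt i plus)
    ≡ᵣ⇒cls      : ∀ x y → InF x → x ≡r y → InF y × cls x ≡ cls y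
    cls⇒≡ᵣ      : ∀ x y → InF x → InF y → cls x ≡ cls y → x ≡r y
    <ᵣ⇒nested   : ∀ i s j t → elt i s <ᵣ elt j t → NestedLt i s j t
    nested⇒<ᵣ   : ∀ i s j t → NestedLt i s j t → elt i s <ᵣ elt j t
    elems-cover : ∀ x → InF x → Σ (Fin (length elems)) λ j → List.lookup elems j ≡ x
    elems-injective : ∀ i j → List.lookup elems i ≡ List.lookup elems j → i ≡ j

unique⇒lookup-injective : ∀ {A : Set} {xs : List A} → Unique xs →
                          ∀ i j → List.lookup xs i ≡ List.lookup xs j → i ≡ j
unique⇒lookup-injective (_ ∷ _) Fin.zero Fin.zero _ = refl
unique⇒lookup-injective (x∉ ∷ _) Fin.zero (Fin.suc j) e = ⊥-elim (All.lookup x∉ (∈-lookup j) e)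
unique⇒lookup-injective (x∉ ∷ _) (Fin.suc i) Fin.zero e = ⊥-elim (All.lookup x∉ (∈-lookup i) (sym e))
unique⇒lookup-injective (_ ∷ u) (Fin.suc i) (Fin.suc j) e = cong Fin.suc (unique⇒lookup-injective u i j e)

∈⇒lookup : ∀ {A : Set} {x : A} {xs : List A} → x ∈ xs →
           Σ (Fin (length xs)) λ j → List.lookup xs j ≡ x
∈⇒lookup x∈ = Any.index x∈ , sym (AnyP.lookup-index x∈)

pairs≡cartesianProduct : ∀ {A B : Set} (xs : List A) (ys : List B) →
  concatMap (λ i → map (λ j → (i , j)) ys) xs ≡ List.cartesianProduct xs ys
pairs≡cartesianProduct []       ys = refl
pairs≡cartesianProduct (x ∷ xs) ys = cong (map (x ,_) ys List.++_) (pairs≡cartesianProduct xs ys)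

-- The enumeration of bit vectors: each vector of length m+1 arises from its
-- tail, which appears exactly once in allVecs m.
private
  extend : ∀ {m} → Vec Bool m → List (Vec Bool (suc m))
  extend v = (true ∷ v) ∷ (false ∷ v) ∷ []

  ∈-extend⁺ : ∀ {m} {v : Vec Bool m} {vs} (b : Bool) → v ∈ vs → (b ∷ v) ∈ concatMap extend vs
  ∈-extend⁺ true  (here refl) = here refl
  ∈-extend⁺ false (here refl) = there (here refl)
  ∈-extend⁺ b     (there p)   = there (there (∈-extend⁺ b p))

  ∈-extend⁻ : ∀ {m} {w : Vec Bool (suc m)} {vs} → w ∈ concatMap extend vs → Vec.tail w ∈ vs
  ∈-extend⁻ {vs = _ ∷ _} (here refl)         = here refl
  ∈-extend⁻ {vs = _ ∷ _} (there (here refl)) = here refl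
  ∈-extend⁻ {vs = _ ∷ _} (there (there p))   = there (∈-extend⁻ p)

  unique-extend : ∀ {m} {vs : List (Vec Bool m)} → Unique vs → Unique (concatMap extend vs)
  unique-extend {vs = []}     []         = []
  unique-extend {vs = v ∷ vs} (v∉ ∷ u) =
    ((λ ()) ∷ tail-differs) ∷ (tail-differs ∷ unique-extend u)
    where
    tail-differs : ∀ {b} → All ((b ∷ v) ≢_) (concatMap extend vs)
    tail-differs = All.tabulate λ w∈ e →
      All.lookup v∉ (subst (_∈ vs) (cong Vec.tail (sym e)) (∈-extend⁻ w∈)) refl

allVecs-complete : ∀ m (v : Vec Bool m) → v ∈ allVecs m
allVecs-complete zero    []      = here refl
allVecs-complete (suc m) (b ∷ v) = ∈-extend⁺ b (allVecs-complete m v)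

allVecs-unique : ∀ m → Unique (allVecs m)
allVecs-unique zero    = [] ∷ []
allVecs-unique (suc m) = unique-extend (allVecs-unique m)

-- Over a regular level L, an element X of the next level
-- picks one element in each class i; `signs X i` is its sign.

decided-true : ∀ {P : Set} (p? : Dec P) → does p? ≡ true → P
decided-true (yes p) _ = p

module SignFunctions (L : Level) (R : Regular L) where
  open Level L renaming (Car to LCar)
  open Derived L
  open Step L
  open Regular R

  k : ℕ
  k = suc k₀

  Mem? : ∀ y X → Dec (Mem y X)
  Mem? y X = FinP.any? (λ i → (List.lookup elems i ≟ y) ×-dec (Vec.lookup X i Bool.≟ true))

  signs : SCar → Fin k → Sign
  signs X i with Mem? (elt i minus) X
  ... | yes _ = minus
  ... | no  _ = plus

  signs-minus : ∀ X i → Mem (elt i minus) X → signs X i ≡ minus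
  signs-minus X i m with Mem? (elt i minus) X
  ... | yes _ = refl
  ... | no ∉ = ⊥-elim (∉ m)

  signs-minus⁻¹ : ∀ X i → signs X i ≡ minus → Mem (elt i minus) X
  signs-minus⁻¹ X i e with Mem? (elt i minus) X
  ... | yes m = m

  InF? : ∀ y → Dec (InF y)
  InF? y with elt (cls y) (sgn y) ≟ y
  ... | yes e = yes (subst InF e (elt-F _ _))
  ... | no ne = no λ fy → ne (elt-cls-sgn y fy)

  Chosen : (Fin k → Sign) → LCar → Set
  Chosen g y = InF y × sgn y ≡ g (cls y)

  Chosen? : ∀ g y → Dec (Chosen g y)
  Chosen? g y = InF? y ×-dec (sgn y ≟Sign g (cls y))

  subset : (Fin k → Sign) → SCar
  subset g = tabulate (λ j → does (Chosen? g (List.lookup elems j)))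

  bitVector-unique : ∀ (Y : SCar) (P : LCar → Set) (P? : ∀ y → Dec (P y)) →
                     (∀ y → Mem y Y → P y) → (∀ y → P y → Mem y Y) →
                     Y ≡ tabulate (λ j → does (P? (List.lookup elems j)))
  bitVector-unique Y P P? sound complete =
    trans (sym (VecP.tabulate∘lookup Y)) (VecP.tabulate-cong bit)
    where
    bit : ∀ j → Vec.lookup Y j ≡ does (P? (List.lookup elems j))
    bit j with Vec.lookup Y j in Yj
    ... | true  = sym (dec-true (P? _) (sound _ (j , refl , Yj)))
    ... | false = sym (dec-false (P? _) λ p → not-member (complete _ p))
      where
      not-member : ¬ Mem (List.lookup elems j) Y
      not-member (j' , e , Yj') with elems-injective j' j e
      ... | refl with trans (sym Yj') Yj
      ...   | ()

  ∈subset⇒chosen : ∀ g y → Mem y (subset g) → Chosen g y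
  ∈subset⇒chosen g y (j , e , bit) = subst (Chosen g) e
    (decided-true (Chosen? g _) (trans (sym (VecP.lookup∘tabulate _ j)) bit))

  chosen⇒∈subset : ∀ g y → Chosen g y → Mem y (subset g)
  chosen⇒∈subset g y ch with elems-cover y (proj₁ ch)
  ... | j , e = j , e , trans (VecP.lookup∘tabulate _ j)
                          (dec-true (Chosen? g _) (subst (Chosen g) (sym e) ch))

  subset-cong : ∀ {g h} → (∀ i → g i ≡ h i) → subset g ≡ subset h
  subset-cong {g} {h} g≗h = VecP.tabulate-cong λ j → does-⇔
    (mk⇔ (λ (fy , s) → fy , trans s (g≗h _)) (λ (fy , s) → fy , trans s (sym (g≗h _))))
    (Chosen? g _) (Chosen? h _)

  elt-chosen : ∀ g i → Chosen g (elt i (g i))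
  elt-chosen g i = elt-F _ _ , trans (sgn-elt _ _) (cong g (sym (cls-elt _ _)))

  signs-subset : ∀ g i → signs (subset g) i ≡ g i
  signs-subset g i with Mem? (elt i minus) (subset g)
  ... | yes m = trans (sym (sgn-elt i minus))
                  (trans (proj₂ (∈subset⇒chosen g _ m)) (cong g (cls-elt i minus)))
  ... | no ∉ with g i in gi
  ...   | plus  = refl
  ...   | minus = ⊥-elim (∉ (chosen⇒∈subset g _ (subst (λ s → Chosen g (elt i s)) gi (elt-chosen g i))))

  subset-F : ∀ g → SInF (subset g)
  subset-F g = (λ x m → proj₁ (∈subset⇒chosen g x m)) , λ x fx →
      elt (cls x) (g (cls x))
    , (chosen⇒∈subset g _ (elt-chosen g (cls x)) , cls⇒≡ᵣ x _ fx (elt-F _ _) (sym (cls-elt _ _)))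
    , λ z z∈ x≡z →
        let (fz , sz) = ∈subset⇒chosen g z z∈
            (_ , cx≡cz) = ≡ᵣ⇒cls x z fx x≡z
        in trans (sym (elt-cls-sgn z fz)) (cong₂ elt (sym cx≡cz) (trans sz (cong g (sym cx≡cz))))

  ∈⇒chosen : ∀ X y → SInF X → Mem y X → Chosen (signs X) y
  ∈⇒chosen X y (inF , unique) y∈ = fy , by-sign (sgn y) refl
    where
    fy = inF y y∈
    by-sign : ∀ s → sgn y ≡ s → sgn y ≡ signs X (cls y)
    by-sign minus e = trans e (sym (signs-minus X (cls y)
      (subst (λ z → Mem z X) (sym (trans (cong (elt (cls y)) (sym e)) (elt-cls-sgn y fy))) y∈)))
    by-sign plus e with Mem? (elt (cls y) minus) X
    ... | no _ = e
    ... | yes m = ⊥-elim (minus≢plus (trans (sym (sgn-elt (cls y) minus)) (trans (cong sgn same) e)))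
      where
      only = proj₂ (proj₂ (unique y fy))
      same : elt (cls y) minus ≡ y
      same = trans (only _ m (cls⇒≡ᵣ y _ fy (elt-F _ _) (sym (cls-elt _ _))))
                   (sym (only y y∈ (cls⇒≡ᵣ y y fy fy refl)))

  chosen⇒∈ : ∀ X y → SInF X → Chosen (signs X) y → Mem y X
  chosen⇒∈ X y (_ , unique) (fy , sy) with signs X (cls y) in e
  ... | minus = subst (λ z → Mem z X) (trans (cong (elt (cls y)) (sym sy)) (elt-cls-sgn y fy))
                  (signs-minus⁻¹ X (cls y) e)
  ... | plus with unique y fy
  ...   | z , (z∈ , y≡z) , _ = subst (λ w → Mem w X) z≡y z∈
    where
    fz = proj₁ (≡ᵣ⇒cls y z fy y≡z)
    cy≡cz = proj₂ (≡ᵣ⇒cls y z fy y≡z)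
    sz : sgn z ≡ plus
    sz = ≢minus⇒plus λ zm → minus≢plus (trans (sym (signs-minus X (cls y)
           (subst (λ w → Mem w X) (trans (sym (elt-cls-sgn z fz)) (cong₂ elt (sym cy≡cz) zm)) z∈))) e)
    z≡y : z ≡ y
    z≡y = trans (sym (elt-cls-sgn z fz))
                (trans (cong₂ elt (sym cy≡cz) (trans sz (sym sy))) (elt-cls-sgn y fy))

  subset-signs : ∀ X → SInF X → X ≡ subset (signs X)
  subset-signs X fX = bitVector-unique X (Chosen (signs X)) (Chosen? (signs X))
    (λ y → ∈⇒chosen X y fX) (λ y → chosen⇒∈ X y fX)

  differsOn⇒signs≢ : ∀ A B x → SInF A → SInF B → InF x → DiffOn A B x →
                     signs A (cls x) ≢ signs B (cls x)
  differsOn⇒signs≢ A B x fA fB fx (y , x≡y , ¬same) e = ¬same (mk⇔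
      (λ y∈A → chosen⇒∈ B y fB (fy , trans (proj₂ (∈⇒chosen A y fA y∈A)) A≡B-at-y))
      (λ y∈B → chosen⇒∈ A y fA (fy , trans (proj₂ (∈⇒chosen B y fB y∈B)) (sym A≡B-at-y))))
    where
    fy = proj₁ (≡ᵣ⇒cls x y fx x≡y)
    cx≡cy = proj₂ (≡ᵣ⇒cls x y fx x≡y)
    A≡B-at-y : signs A (cls y) ≡ signs B (cls y)
    A≡B-at-y = subst (λ i → signs A i ≡ signs B i) cx≡cy e

  signs≢⇒differsOn : ∀ A B x → SInF A → SInF B → InF x →
                     signs A (cls x) ≢ signs B (cls x) → DiffOn A B x
  signs≢⇒differsOn A B x fA fB fx ne =
    y , cls⇒≡ᵣ x y fx (elt-F _ _) (sym (cls-elt _ _)) , λ same →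
      ne (trans (sym (sgn-elt _ _)) (trans (proj₂ (∈⇒chosen B y fB (to same y∈A))) (cong (signs B) (cls-elt _ _))))
    where
    y = elt (cls x) (signs A (cls x))
    y∈A : Mem y A
    y∈A = chosen⇒∈ A y fA (elt-chosen (signs A) (cls x))

  nested⇒≤ᵣ : ∀ x y → InF x → InF y → NestedLe (cls x) (sgn x) (cls y) (sgn y) → x ≤ᵣ y
  nested⇒≤ᵣ x y fx fy (inj₁ (ci , si)) =
    inj₁ (trans (sym (elt-cls-sgn x fx)) (trans (cong₂ elt ci si) (elt-cls-sgn y fy)))
  nested⇒≤ᵣ x y fx fy (inj₂ lt) =
    inj₂ (subst₂ _<ᵣ_ (elt-cls-sgn x fx) (elt-cls-sgn y fy) (nested⇒<ᵣ _ _ _ _ lt))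

  ⪯⇒cls≤ : ∀ x y → InF x → InF y → x ⪯ y → toℕ (cls x) ≤ toℕ (cls y)
  ⪯⇒cls≤ x y fx fy (mx , my , (mx⁻ , x≡mx) , (my⁻ , y≡my) , mx≤my) with mx≤my
  ... | inj₁ refl = ℕP.≤-reflexive (cong toℕ (trans cx≡cm (sym cy≡cm)))
    where
    cx≡cm = proj₂ (≡ᵣ⇒cls x mx fx x≡mx)
    cy≡cm = proj₂ (≡ᵣ⇒cls y my fy y≡my)
  ... | inj₂ mx<my with <ᵣ⇒nested _ _ _ _ (subst₂ _<ᵣ_ (sym (elt-cls-sgn mx fmx)) (sym (elt-cls-sgn my fmy)) mx<my)
    where
    fmx = proj₁ (F⁻⇒minus mx mx⁻)
    fmy = proj₁ (F⁻⇒minus my my⁻)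
  ...   | inj₁ (lt , _) = subst₂ (λ a b → toℕ a ≤ toℕ b) (sym (proj₂ (≡ᵣ⇒cls x mx fx x≡mx)))
                            (sym (proj₂ (≡ᵣ⇒cls y my fy y≡my))) (ℕP.<⇒≤ lt)
  ...   | inj₂ (inj₁ (_ , p))     = ⊥-elim (minus≢plus (trans (sym (proj₂ (F⁻⇒minus my my⁻))) p))
  ...   | inj₂ (inj₂ (_ , _ , p)) = ⊥-elim (minus≢plus (trans (sym (proj₂ (F⁻⇒minus my my⁻))) p))

  cls≤⇒⪯ : ∀ x y → InF x → InF y → toℕ (cls x) ≤ toℕ (cls y) → x ⪯ y
  cls≤⇒⪯ x y fx fy cx≤cy = elt (cls x) minus , elt (cls y) minus
    , (elt-F⁻ _ , cls⇒≡ᵣ x _ fx (elt-F _ _) (sym (cls-elt _ _)))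
    , (elt-F⁻ _ , cls⇒≡ᵣ y _ fy (elt-F _ _) (sym (cls-elt _ _)))
    , compare (FinP.<-cmp (cls x) (cls y))
    where
    compare : _ → elt (cls x) minus ≤ᵣ elt (cls y) minus
    compare (tri< lt _ _) = inj₂ (nested⇒<ᵣ _ _ _ _ (inj₁ (lt , refl)))
    compare (tri≈ _ e _)  = inj₁ (cong (λ i → elt i minus) e)
    compare (tri> _ _ gt) = ⊥-elim (ℕP.<⇒≱ gt cx≤cy)

  γ⇒firstDiff : ∀ A B C → SInF A → SInF B → SGamma A B C →
                InF C × FirstDiff (signs A) (signs B) (cls C) × sgn C ≡ signs B (cls C)
  γ⇒firstDiff A B C fA fB (C∈B , fC , diffC , firstC) =
    fC , (differsOn⇒signs≢ A B C fA fB fC diffC , first) , proj₂ (∈⇒chosen B C fB C∈B)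
    where
    first : ∀ j → signs A j ≢ signs B j → toℕ (cls C) ≤ toℕ j
    first j ne = subst (λ i → toℕ (cls C) ≤ toℕ i) (cls-elt j minus)
      (⪯⇒cls≤ C _ fC (elt-F _ _) (firstC _ (elt-F j minus)
        (signs≢⇒differsOn A B _ fA fB (elt-F _ _)
          (subst (λ i → signs A i ≢ signs B i) (sym (cls-elt j minus)) ne))))

  firstDiff⇒γ : ∀ A B C → SInF A → SInF B → InF C → FirstDiff (signs A) (signs B) (cls C) →
                sgn C ≡ signs B (cls C) → SGamma A B C
  firstDiff⇒γ A B C fA fB fC (ne , first) sC =
      chosen⇒∈ B C fB (fC , sC) , fC , signs≢⇒differsOn A B C fA fB fC ne
    , λ y fy diffy → cls≤⇒⪯ C y fC fy (first (cls y) (differsOn⇒signs≢ A B y fA fB fy diffy))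

  <⇒lexLt : ∀ A B → SInF A → SInF B → SLt A B → LexLt (signs A) (signs B)
  <⇒lexLt A B fA fB (C , γC , C⁺) with γ⇒firstDiff A B C fA fB γC
  ... | _ , diff , sC = cls C , diff , trans (sym sC) (proj₂ (F⁺⇒plus C C⁺))

  lexLt⇒< : ∀ A B → SInF A → SInF B → LexLt (signs A) (signs B) → SLt A B
  lexLt⇒< A B fA fB (d , diff , Bd) = elt d plus
    , firstDiff⇒γ A B (elt d plus) fA fB (elt-F d plus)
        (subst (FirstDiff (signs A) (signs B)) (sym (cls-elt d plus)) diff)
        (trans (sgn-elt d plus) (trans (sym Bd) (cong (signs B) (sym (cls-elt d plus)))))
    , elt-F⁺ d

  ≤⇒lexLe : ∀ A B → SInF A → SInF B → A ≡ B ⊎ SLt A B → LexLe (signs A) (signs B)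
  ≤⇒lexLe A B _  _  (inj₁ refl) = inj₁ λ _ → refl
  ≤⇒lexLe A B fA fB (inj₂ A<B)  = inj₂ (<⇒lexLt A B fA fB A<B)

  theorem-above-regular : ∀ A B A' B' → SInF A → SInF B → SInF A' → SInF B' →
    ((A ≡ A' ⊎ SLt A A') → (C C' : LCar) → SGamma A B C → SGamma A' B C' → C' ≤ᵣ C)
    ×
    ((B ≡ B' ⊎ SLt B B') → (C C' : LCar) → SGamma A B C → SGamma A B' C' → C ≤ᵣ C')
  theorem-above-regular A B A' B' fA fB fA' fB' = part-i , part-ii
    where
    part-i : _
    part-i A≤A' C C' γC γC'
      with γ⇒firstDiff A B C fA fB γC | γ⇒firstDiff A' B C' fA' fB γC'
    ... | fC , diff , sC | fC' , diff' , sC' = nested⇒≤ᵣ C' C fC' fC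
      (subst₂ (λ s t → NestedLe (cls C') s (cls C) t) (sym sC') (sym sC)
        (firstDiff-antitoneˡ diff diff' (≤⇒lexLe A A' fA fA' A≤A')))
    part-ii : _
    part-ii B≤B' C C' γC γC'
      with γ⇒firstDiff A B C fA fB γC | γ⇒firstDiff A B' C' fA fB' γC'
    ... | fC , diff , sC | fC' , diff' , sC' = nested⇒≤ᵣ C C' fC fC'
      (subst₂ (λ s t → NestedLe (cls C) s (cls C') t) (sym sC) (sym sC')
        (firstDiff-monotoneʳ diff diff' (≤⇒lexLe B B' fB fB' B≤B')))

-- The classes of the next level are the sign vectors of
-- length k₀ (sign functions up to a global flip), ordered lexicographically;
-- reading - as 0 and + as 1 numbers them in order by Fin (2^k₀).

value : ∀ {m} → Vec Sign m → ℕ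
value []                  = 0
value (minus ∷ v)         = value v
value {suc m} (plus ∷ v)  = 2 ^ m + value v

value<2^ : ∀ {m} (v : Vec Sign m) → value v ℕ.< 2 ^ m
value<2^ []                 = s≤s z≤n
value<2^ {suc m} (minus ∷ v) = ℕP.<-≤-trans (value<2^ v) (ℕP.m≤m+n _ _)
value<2^ {suc m} (plus ∷ v)  =
  ℕP.+-monoʳ-< (2 ^ m) (subst (value v ℕ.<_) (sym (ℕP.+-identityʳ _)) (value<2^ v))

LexVec : ∀ {m} → Vec Sign m → Vec Sign m → Set
LexVec []      []      = ⊥
LexVec (s ∷ a) (t ∷ b) = (s ≡ minus × t ≡ plus) ⊎ (s ≡ t × LexVec a b)

lexVec⇒value< : ∀ {m} (a b : Vec Sign m) → LexVec a b → value a ℕ.< value b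
lexVec⇒value< [] [] ()
lexVec⇒value< {suc m} (minus ∷ a) (plus ∷ b)  (inj₁ (refl , refl)) =
  ℕP.<-≤-trans (value<2^ a) (ℕP.m≤m+n _ _)
lexVec⇒value< {suc m} (minus ∷ a) (minus ∷ b) (inj₂ (refl , lt)) = lexVec⇒value< a b lt
lexVec⇒value< {suc m} (plus ∷ a)  (plus ∷ b)  (inj₂ (refl , lt)) =
  ℕP.+-monoʳ-< (2 ^ m) (lexVec⇒value< a b lt)

private
  cons-trichotomy : ∀ {m} {a b : Vec Sign m} s → LexVec a b ⊎ a ≡ b ⊎ LexVec b a →
                    LexVec (s ∷ a) (s ∷ b) ⊎ s ∷ a ≡ s ∷ b ⊎ LexVec (s ∷ b) (s ∷ a)
  cons-trichotomy s (inj₁ lt)          = inj₁ (inj₂ (refl , lt))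
  cons-trichotomy s (inj₂ (inj₁ refl)) = inj₂ (inj₁ refl)
  cons-trichotomy s (inj₂ (inj₂ gt))   = inj₂ (inj₂ (inj₂ (refl , gt)))

lexVec-trichotomy : ∀ {m} (a b : Vec Sign m) → LexVec a b ⊎ a ≡ b ⊎ LexVec b a
lexVec-trichotomy []          []          = inj₂ (inj₁ refl)
lexVec-trichotomy (minus ∷ a) (plus ∷ b)  = inj₁ (inj₁ (refl , refl))
lexVec-trichotomy (plus ∷ a)  (minus ∷ b) = inj₂ (inj₂ (inj₁ (refl , refl)))
lexVec-trichotomy (minus ∷ a) (minus ∷ b) = cons-trichotomy minus (lexVec-trichotomy a b)
lexVec-trichotomy (plus ∷ a)  (plus ∷ b)  = cons-trichotomy plus (lexVec-trichotomy a b)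

value<⇒lexVec : ∀ {m} (a b : Vec Sign m) → value a ℕ.< value b → LexVec a b
value<⇒lexVec a b lt with lexVec-trichotomy a b
... | inj₁ a<b         = a<b
... | inj₂ (inj₁ refl) = ⊥-elim (ℕP.<-irrefl refl lt)
... | inj₂ (inj₂ b<a)  = ⊥-elim (ℕP.<-asym lt (lexVec⇒value< b a b<a))

fromValue : (m : ℕ) → ℕ → Vec Sign m
fromValue zero    x = []
fromValue (suc m) x with 2 ^ m ℕ.≤? x
... | yes _ = plus ∷ fromValue m (x ∸ 2 ^ m)
... | no  _ = minus ∷ fromValue m x

value-fromValue : ∀ m x → x ℕ.< 2 ^ m → value (fromValue m x) ≡ x
value-fromValue zero    zero    _ = refl
value-fromValue zero    (suc x) (s≤s ())
value-fromValue (suc m) x x<2^m+1 with 2 ^ m ℕ.≤? x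
... | yes 2^m≤x = trans (cong (2 ^ m +_) (value-fromValue m (x ∸ 2 ^ m) rest<2^m)) (ℕP.m+[n∸m]≡n 2^m≤x)
  where
  rest<2^m : x ∸ 2 ^ m ℕ.< 2 ^ m
  rest<2^m = subst (x ∸ 2 ^ m ℕ.<_) (trans (ℕP.m+n∸m≡n (2 ^ m) _) (ℕP.+-identityʳ _))
                   (ℕP.∸-monoˡ-< x<2^m+1 2^m≤x)
... | no 2^m≰x = value-fromValue m x (ℕP.≰⇒> 2^m≰x)

fromValue-value : ∀ {m} (v : Vec Sign m) → fromValue m (value v) ≡ v
fromValue-value [] = refl
fromValue-value {suc m} (minus ∷ v) with 2 ^ m ℕ.≤? value v
... | yes 2^m≤ = ⊥-elim (ℕP.<⇒≱ (value<2^ v) 2^m≤)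
... | no  _    = cong (minus ∷_) (fromValue-value v)
fromValue-value {suc m} (plus ∷ v) with 2 ^ m ℕ.≤? (2 ^ m + value v)
... | yes _ = cong (plus ∷_) (trans (cong (fromValue m) (ℕP.m+n∸m≡n (2 ^ m) (value v))) (fromValue-value v))
... | no 2^m≰ = ⊥-elim (2^m≰ (ℕP.m≤m+n _ _))

-- The same bijection with Fin (suc (pred (2^m))), the form a class index takes.
pred2^ : ℕ → ℕ
pred2^ m = pred (2 ^ m)

suc-pred2^ : ∀ m → suc (pred2^ m) ≡ 2 ^ m
suc-pred2^ m = ℕP.suc-pred (2 ^ m) {{ℕP.m^n≢0 2 m}}

vecToFin : ∀ {m} → Vec Sign m → Fin (suc (pred2^ m))
vecToFin {m} v = Fin.fromℕ< (subst (value v ℕ.<_) (sym (suc-pred2^ m)) (value<2^ v))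

finToVec : ∀ {m} → Fin (suc (pred2^ m)) → Vec Sign m
finToVec {m} i = fromValue m (toℕ i)

toℕ-vecToFin : ∀ {m} (v : Vec Sign m) → toℕ (vecToFin v) ≡ value v
toℕ-vecToFin v = FinP.toℕ-fromℕ< _

finToVec-vecToFin : ∀ {m} (v : Vec Sign m) → finToVec (vecToFin v) ≡ v
finToVec-vecToFin {m} v = trans (cong (fromValue m) (toℕ-vecToFin v)) (fromValue-value v)

value-finToVec : ∀ {m} (i : Fin (suc (pred2^ m))) → value (finToVec {m} i) ≡ toℕ i
value-finToVec {m} i = value-fromValue m (toℕ i) (subst (toℕ i ℕ.<_) (suc-pred2^ m) (FinP.toℕ<n i))

vecToFin-finToVec : ∀ {m} (i : Fin (suc (pred2^ m))) → vecToFin (finToVec {m} i) ≡ i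
vecToFin-finToVec {m} i = FinP.toℕ-injective (trans (toℕ-vecToFin (finToVec {m} i)) (value-finToVec {m} i))

flipVec : ∀ {m} → Vec Sign m → Vec Sign m
flipVec = Vec.map flipSign

flipVec-involutive : ∀ {m} (v : Vec Sign m) → flipVec (flipVec v) ≡ v
flipVec-involutive []      = refl
flipVec-involutive (s ∷ v) = cong₂ _∷_ (flipSign-involutive s) (flipVec-involutive v)

lexVec-flip : ∀ {m} (a b : Vec Sign m) → LexVec a b → LexVec (flipVec b) (flipVec a)
lexVec-flip [] [] ()
lexVec-flip (minus ∷ a) (plus ∷ b) (inj₁ (refl , refl)) = inj₁ (refl , refl)
lexVec-flip (s ∷ a)     (.s ∷ b)   (inj₂ (refl , lt))   = inj₂ (refl , lexVec-flip a b lt)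

lexVec-flip⁻¹ : ∀ {m} (a b : Vec Sign m) → LexVec (flipVec b) (flipVec a) → LexVec a b
lexVec-flip⁻¹ a b lt =
  subst₂ LexVec (flipVec-involutive a) (flipVec-involutive b) (lexVec-flip (flipVec b) (flipVec a) lt)

-- The representative of the class of a sign vector with leading sign s:
-- the tail is flipped exactly when s = +.
normalise : ∀ {m} → Sign → Vec Sign m → Vec Sign m
normalise minus a = a
normalise plus  a = flipVec a

normalise-involutive : ∀ {m} s (a : Vec Sign m) → normalise s (normalise s a) ≡ a
normalise-involutive minus a = refl
normalise-involutive plus  a = flipVec-involutive a

normalise-flip : ∀ {m} s (a : Vec Sign m) → normalise (flipSign s) (flipVec a) ≡ normalise s a
normalise-flip minus a = flipVec-involutive a
normalise-flip plus  a = refl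

lexLt⇒lexVec : ∀ {m} (f g : Fin m → Sign) → LexLt f g → LexVec (tabulate f) (tabulate g)
lexLt⇒lexVec {suc m} f g (Fin.zero , diff , g0) =
  inj₁ (≢plus⇒minus (λ e → proj₁ diff (trans e (sym g0))) , g0)
lexLt⇒lexVec {suc m} f g (Fin.suc d , diff , gd) =
  inj₂ (agree-before diff (s≤s z≤n) ,
        lexLt⇒lexVec (f ∘ Fin.suc) (g ∘ Fin.suc)
          (d , (proj₁ diff , λ j ne → ℕP.≤-pred (proj₂ diff (Fin.suc j) ne)) , gd))

lexVec⇒lexLt : ∀ {m} (f g : Fin m → Sign) → LexVec (tabulate f) (tabulate g) → LexLt f g
lexVec⇒lexLt {suc m} f g (inj₁ (f0 , g0)) =
  Fin.zero , ((λ e → minus≢plus (trans (sym f0) (trans e g0))) , (λ _ _ → z≤n)) , g0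
lexVec⇒lexLt {suc m} f g (inj₂ (f0≡g0 , lt)) with lexVec⇒lexLt (f ∘ Fin.suc) (g ∘ Fin.suc) lt
... | d , (ne , first) , gd = Fin.suc d , (ne , first') , gd
  where
  first' : ∀ j → f j ≢ g j → suc (toℕ d) ≤ toℕ j
  first' Fin.zero    ne₀ = ⊥-elim (ne₀ f0≡g0)
  first' (Fin.suc j) neⱼ = s≤s (first j neⱼ)

tabulate-≡⇒≗ : ∀ {A : Set} {m} {f g : Fin m → A} → tabulate f ≡ tabulate g → ∀ i → f i ≡ g i
tabulate-≡⇒≗ {f = f} {g} e i =
  trans (sym (VecP.lookup∘tabulate f i)) (trans (cong (λ v → Vec.lookup v i) e) (VecP.lookup∘tabulate g i))

normalise-≡ : ∀ {m} s t (a b : Vec Sign m) → normalise s a ≡ normalise t b →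
              (t ≡ s × b ≡ a) ⊎ (t ≡ flipSign s × b ≡ flipVec a)
normalise-≡ minus minus a b e = inj₁ (refl , sym e)
normalise-≡ plus  plus  a b e =
  inj₁ (refl , trans (sym (flipVec-involutive b)) (trans (cong flipVec (sym e)) (flipVec-involutive a)))
normalise-≡ minus plus  a b e = inj₂ (refl , trans (sym (flipVec-involutive b)) (cong flipVec (sym e)))
normalise-≡ plus  minus a b e = inj₂ (refl , sym e)

-- An element X is coded
-- by its leading sign `signs X 0` and its class: the tail of its sign
-- function, flipped when the leading sign is +, read as a number.
module NextLevel (L : Level) (R : Regular L) where
  open Level L renaming (Car to LCar)
  open Derived L
  open Step L
  open Regular R
  open SignFunctions L R

  classVec : (Fin k → Sign) → Vec Sign k₀
  classVec f = normalise (f Fin.zero) (tabulate (f ∘ Fin.suc))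

  classVec-cong : ∀ {f g : Fin k → Sign} → (∀ i → f i ≡ g i) → classVec f ≡ classVec g
  classVec-cong f≗g = cong₂ normalise (f≗g Fin.zero) (VecP.tabulate-cong (f≗g ∘ Fin.suc))

  classVec-flip : ∀ (f : Fin k → Sign) → classVec (flipSign ∘ f) ≡ classVec f
  classVec-flip f = trans (cong (normalise (flipSign (f Fin.zero))) (VecP.tabulate-∘ flipSign (f ∘ Fin.suc)))
                          (normalise-flip (f Fin.zero) _)

  classVec-≡ : ∀ (f g : Fin k → Sign) → classVec f ≡ classVec g →
               (∀ i → g i ≡ f i) ⊎ (∀ i → g i ≡ flipSign (f i))
  classVec-≡ f g e with normalise-≡ (f Fin.zero) (g Fin.zero) _ _ e
  ... | inj₁ (g0 , tail) = inj₁ (tabulate-≡⇒≗ (cong₂ _∷_ g0 tail))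
  ... | inj₂ (g0 , tail) = inj₂ (tabulate-≡⇒≗ (cong₂ _∷_ g0
          (trans tail (sym (VecP.tabulate-∘ flipSign (f ∘ Fin.suc))))))

  cls' : SCar → Fin (suc (pred2^ k₀))
  cls' X = vecToFin (classVec (signs X))

  sgn' : SCar → Sign
  sgn' X = signs X Fin.zero

  signsOf : Fin (suc (pred2^ k₀)) → Sign → Fin k → Sign
  signsOf c s = Vec.lookup (s ∷ normalise s (finToVec {k₀} c))

  elt' : Fin (suc (pred2^ k₀)) → Sign → SCar
  elt' c s = subset (signsOf c s)

  tabulate-signsOf : ∀ c s → tabulate (signsOf c s) ≡ s ∷ normalise s (finToVec {k₀} c)
  tabulate-signsOf c s = VecP.tabulate∘lookup _

  cls'-elt' : ∀ c s → cls' (elt' c s) ≡ c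
  cls'-elt' c s = begin
    vecToFin (classVec (signs (subset (signsOf c s))))
      ≡⟨ cong vecToFin (classVec-cong (signs-subset (signsOf c s))) ⟩
    vecToFin (normalise s (tabulate (Vec.lookup (normalise s (finToVec {k₀} c)))))
      ≡⟨ cong (vecToFin ∘ normalise s) (VecP.tabulate∘lookup _) ⟩
    vecToFin (normalise s (normalise s (finToVec {k₀} c)))
      ≡⟨ cong vecToFin (normalise-involutive s _) ⟩
    vecToFin (finToVec {k₀} c)
      ≡⟨ vecToFin-finToVec {k₀} c ⟩
    c ∎
    where open ≡-Reasoning

  sgn'-elt' : ∀ c s → sgn' (elt' c s) ≡ s
  sgn'-elt' c s = signs-subset (signsOf c s) Fin.zero

  elt'-cls'-sgn' : ∀ X → SInF X → elt' (cls' X) (sgn' X) ≡ X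
  elt'-cls'-sgn' X fX = trans (subset-cong same) (sym (subset-signs X fX))
    where
    s = signs X Fin.zero
    same : ∀ i → signsOf (cls' X) s i ≡ signs X i
    same Fin.zero    = refl
    same (Fin.suc j) = begin
      Vec.lookup (normalise s (finToVec (vecToFin (classVec (signs X))))) j
        ≡⟨ cong (λ v → Vec.lookup (normalise s v) j) (finToVec-vecToFin (classVec (signs X))) ⟩
      Vec.lookup (normalise s (normalise s (tabulate (signs X ∘ Fin.suc)))) j
        ≡⟨ cong (λ v → Vec.lookup v j) (normalise-involutive s _) ⟩
      Vec.lookup (tabulate (signs X ∘ Fin.suc)) j
        ≡⟨ VecP.lookup∘tabulate _ j ⟩
      signs X (Fin.suc j) ∎
      where open ≡-Reasoning

  isMin-elt₀ : IsMin (elt Fin.zero minus)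
  isMin-elt₀ = elt-F _ _ , λ y fy → subst (elt Fin.zero minus ≤ᵣ_) (elt-cls-sgn y fy) (above (cls y) (sgn y))
    where
    above : ∀ i s → elt Fin.zero minus ≤ᵣ elt i s
    above Fin.zero    minus = inj₁ refl
    above Fin.zero    plus  = inj₂ (nested⇒<ᵣ _ _ _ _ (inj₂ (inj₂ (refl , refl , refl))))
    above (Fin.suc i) s     = inj₂ (nested⇒<ᵣ _ _ _ _ (inj₁ (s≤s z≤n , refl)))

  isMin⇒elt₀ : ∀ m → IsMin m → m ≡ elt Fin.zero minus
  isMin⇒elt₀ m (fm , least) with least (elt Fin.zero minus) (elt-F _ _)
  ... | inj₁ e = e
  ... | inj₂ lt with <ᵣ⇒nested _ _ _ _ (subst (_<ᵣ elt Fin.zero minus) (sym (elt-cls-sgn m fm)) lt)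
  ...   | inj₁ (() , _)
  ...   | inj₂ (inj₁ (_ , ()))
  ...   | inj₂ (inj₂ (_ , _ , ()))

  isMax-elt₀ : IsMax (elt Fin.zero plus)
  isMax-elt₀ = elt-F _ _ , λ y fy → subst (_≤ᵣ elt Fin.zero plus) (elt-cls-sgn y fy) (below (cls y) (sgn y))
    where
    below : ∀ i s → elt i s ≤ᵣ elt Fin.zero plus
    below Fin.zero    plus  = inj₁ refl
    below Fin.zero    minus = inj₂ (nested⇒<ᵣ _ _ _ _ (inj₂ (inj₂ (refl , refl , refl))))
    below (Fin.suc i) s     = inj₂ (nested⇒<ᵣ _ _ _ _ (inj₂ (inj₁ (s≤s z≤n , refl))))

  isMax⇒elt₀ : ∀ m → IsMax m → m ≡ elt Fin.zero plus
  isMax⇒elt₀ m (fm , greatest) with greatest (elt Fin.zero plus) (elt-F _ _)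
  ... | inj₁ e = sym e
  ... | inj₂ lt with <ᵣ⇒nested _ _ _ _ (subst (elt Fin.zero plus <ᵣ_) (sym (elt-cls-sgn m fm)) lt)
  ...   | inj₁ (_ , ())
  ...   | inj₂ (inj₁ (() , _))
  ...   | inj₂ (inj₂ (_ , () , _))

  F⁻⇒minus' : ∀ X → SInF⁻ X → SInF X × sgn' X ≡ minus
  F⁻⇒minus' X (fX , m , isMin , m∈X) =
    fX , signs-minus X Fin.zero (subst (λ z → Mem z X) (isMin⇒elt₀ m isMin) m∈X)

  leading-minus⇒F⁻ : ∀ X → SInF X → sgn' X ≡ minus → SInF⁻ X
  leading-minus⇒F⁻ X fX X₀ = fX , elt Fin.zero minus , isMin-elt₀ , signs-minus⁻¹ X Fin.zero X₀

  elt'-F⁻ : ∀ c → SInF⁻ (elt' c minus)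
  elt'-F⁻ c = leading-minus⇒F⁻ (elt' c minus) (subset-F (signsOf c minus)) (sgn'-elt' c minus)

  F⁺⇒plus' : ∀ X → SInF⁺ X → SInF X × sgn' X ≡ plus
  F⁺⇒plus' X (fX , m , isMax , m∈X) = fX ,
    trans (cong (signs X) (sym (cls-elt Fin.zero plus)))
      (trans (sym (proj₂ (∈⇒chosen X _ fX (subst (λ z → Mem z X) (isMax⇒elt₀ m isMax) m∈X))))
             (sgn-elt _ _))

  elt'-F⁺ : ∀ c → SInF⁺ (elt' c plus)
  elt'-F⁺ c = subset-F (signsOf c plus) , elt Fin.zero plus , isMax-elt₀ ,
    chosen⇒∈ X _ (subset-F (signsOf c plus)) (subst (λ s → Chosen (signs X) (elt Fin.zero s)) (sgn'-elt' c plus)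
                                        (elt-chosen (signs X) Fin.zero))
    where X = elt' c plus

  OtherInClass : SCar → LCar → Set
  OtherInClass X y = Σ LCar λ x → Mem x X × x ≡r y × x ≢ y

  other⇒chosen-flipped : ∀ X y → SInF X → OtherInClass X y → Chosen (flipSign ∘ signs X) y
  other⇒chosen-flipped X y fX (x , x∈X , x≡y , x≢y) = fy , trans sy (cong (flipSign ∘ signs X) cx≡cy)
    where
    fx = proj₁ (∈⇒chosen X x fX x∈X)
    fy = proj₁ (≡ᵣ⇒cls x y fx x≡y)
    cx≡cy = proj₂ (≡ᵣ⇒cls x y fx x≡y)
    sy : sgn y ≡ flipSign (signs X (cls x))
    sy = trans (≢⇒flipSign λ e → x≢y (trans (sym (elt-cls-sgn x fx))
                                     (trans (cong₂ elt cx≡cy (sym e)) (elt-cls-sgn y fy))))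
               (cong flipSign (proj₂ (∈⇒chosen X x fX x∈X)))

  chosen-flipped⇒other : ∀ X y → SInF X → Chosen (flipSign ∘ signs X) y → OtherInClass X y
  chosen-flipped⇒other X y fX (fy , sy) = x
    , chosen⇒∈ X x fX (elt-chosen (signs X) (cls y))
    , cls⇒≡ᵣ x y (elt-F _ _) fy (cls-elt _ _)
    , λ e → flipSign-≢ _ (trans (sym sy) (trans (cong sgn (sym e)) (sgn-elt _ _)))
    where
    x = elt (cls y) (signs X (cls y))

  σ⇒flipped : ∀ X Y → IsSigma X Y → Y ≡ subset (flipSign ∘ signs X)
  σ⇒flipped X Y ((fX , _) , members) =
    bitVector-unique Y (Chosen (flipSign ∘ signs X)) (Chosen? (flipSign ∘ signs X))
      (λ y y∈Y → other⇒chosen-flipped X y fX (to (members y) y∈Y))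
      (λ y ch → from (members y) (chosen-flipped⇒other X y fX ch))

  flipped⇒σ : ∀ X Y → SInF⁻ X → SInF Y → (∀ i → signs Y i ≡ flipSign (signs X i)) → IsSigma X Y
  flipped⇒σ X Y X⁻@(fX , _) fY flipped = X⁻ , λ y → mk⇔
    (λ y∈Y → let (fy , s) = ∈⇒chosen Y y fY y∈Y in chosen-flipped⇒other X y fX (fy , trans s (flipped _)))
    (λ other → let (fy , s) = other⇒chosen-flipped X y fX other
               in chosen⇒∈ Y y fY (fy , trans s (sym (flipped _))))

  σ⇒same-cls : ∀ X Y → IsSigma X Y → SInF Y × cls' X ≡ cls' Y
  σ⇒same-cls X Y σXY =
      subst SInF (sym Y≡) (subset-F (flipSign ∘ signs X))
    , cong vecToFin (trans (sym (classVec-flip (signs X)))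
        (classVec-cong λ i → sym (trans (cong (λ Z → signs Z i) Y≡) (signs-subset (flipSign ∘ signs X) i))))
    where
    Y≡ = σ⇒flipped X Y σXY

  ≡ᵣ⇒cls' : ∀ X Y → SInF X → SEq X Y → SInF Y × cls' X ≡ cls' Y
  ≡ᵣ⇒cls' X Y fX (inj₁ refl)          = fX , refl
  ≡ᵣ⇒cls' X Y fX (inj₂ (inj₁ σYX))    = proj₁ (proj₁ σYX) , sym (proj₂ (σ⇒same-cls Y X σYX))
  ≡ᵣ⇒cls' X Y fX (inj₂ (inj₂ σXY))    = σ⇒same-cls X Y σXY

  cls'⇒≡ᵣ : ∀ X Y → SInF X → SInF Y → cls' X ≡ cls' Y → SEq X Y
  cls'⇒≡ᵣ X Y fX fY cX≡cY with classVec-≡ (signs X) (signs Y) same-classVec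
    where
    same-classVec : classVec (signs X) ≡ classVec (signs Y)
    same-classVec = trans (sym (finToVec-vecToFin _)) (trans (cong finToVec cX≡cY) (finToVec-vecToFin _))
  ... | inj₁ same = inj₁ (begin
    X                   ≡⟨ subset-signs X fX ⟩
    subset (signs X)    ≡⟨ subset-cong (λ i → sym (same i)) ⟩
    subset (signs Y)    ≡⟨ subset-signs Y fY ⟨
    Y                   ∎)
    where open ≡-Reasoning
  ... | inj₂ flipped with signs X Fin.zero in X₀
  ...   | minus = inj₂ (inj₂ (flipped⇒σ X Y (leading-minus⇒F⁻ X fX X₀) fY flipped))
  ...   | plus  = inj₂ (inj₁ (flipped⇒σ Y X (leading-minus⇒F⁻ Y fY Y₀) fX flipped'))
    where
    flipped' : ∀ i → signs X i ≡ flipSign (signs Y i)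
    flipped' i = trans (sym (flipSign-involutive _)) (cong flipSign (sym (flipped i)))
    Y₀ : sgn' Y ≡ minus
    Y₀ = trans (flipped Fin.zero) (cong flipSign X₀)

  -- The order: at the next level <_r is lexicographic on sign functions,
  -- which on (class, sign) codes is exactly the nested order.
  lexVec⇒nested : ∀ c s d t → LexVec (s ∷ normalise s (finToVec {k₀} c)) (t ∷ normalise t (finToVec {k₀} d)) →
                  NestedLt c s d t
  lexVec⇒nested c minus d minus (inj₁ (_ , ()))
  lexVec⇒nested c minus d minus (inj₂ (_ , lt)) =
    inj₁ (subst₂ ℕ._<_ (value-finToVec {k₀} c) (value-finToVec {k₀} d) (lexVec⇒value< _ _ lt) , refl)
  lexVec⇒nested c minus d plus _ with FinP.<-cmp c d
  ... | tri< c<d _ _ = inj₁ (c<d , refl)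
  ... | tri≈ _ c≡d _ = inj₂ (inj₂ (c≡d , refl , refl))
  ... | tri> _ _ d<c = inj₂ (inj₁ (d<c , refl))
  lexVec⇒nested c plus d minus (inj₁ (() , _))
  lexVec⇒nested c plus d minus (inj₂ (() , _))
  lexVec⇒nested c plus d plus  (inj₁ (() , _))
  lexVec⇒nested c plus d plus  (inj₂ (_ , lt)) =
    inj₂ (inj₁ (subst₂ ℕ._<_ (value-finToVec {k₀} d) (value-finToVec {k₀} c)
      (lexVec⇒value< _ _ (lexVec-flip⁻¹ (finToVec {k₀} d) (finToVec {k₀} c) lt)) , refl))

  nested⇒lexVec : ∀ c s d t → NestedLt c s d t →
                  LexVec (s ∷ normalise s (finToVec {k₀} c)) (t ∷ normalise t (finToVec {k₀} d))
  nested⇒lexVec c minus d minus (inj₁ (c<d , _)) =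
    inj₂ (refl , value<⇒lexVec _ _ (subst₂ ℕ._<_ (sym (value-finToVec {k₀} c)) (sym (value-finToVec {k₀} d)) c<d))
  nested⇒lexVec c minus d plus  _ = inj₁ (refl , refl)
  nested⇒lexVec c plus  d plus  (inj₂ (inj₁ (d<c , _))) =
    inj₂ (refl , lexVec-flip (finToVec {k₀} d) (finToVec {k₀} c)
      (value<⇒lexVec _ _ (subst₂ ℕ._<_ (sym (value-finToVec {k₀} d)) (sym (value-finToVec {k₀} c)) d<c)))
  nested⇒lexVec c minus d minus (inj₂ (inj₁ (_ , ())))
  nested⇒lexVec c minus d minus (inj₂ (inj₂ (_ , _ , ())))
  nested⇒lexVec c plus  d minus (inj₁ (_ , ()))
  nested⇒lexVec c plus  d minus (inj₂ (inj₁ (_ , ())))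
  nested⇒lexVec c plus  d minus (inj₂ (inj₂ (_ , () , _)))
  nested⇒lexVec c plus  d plus  (inj₁ (_ , ()))
  nested⇒lexVec c plus  d plus  (inj₂ (inj₂ (_ , () , _)))

  tabulate-signs-elt' : ∀ c s → tabulate (signs (elt' c s)) ≡ s ∷ normalise s (finToVec {k₀} c)
  tabulate-signs-elt' c s = trans (VecP.tabulate-cong (signs-subset (signsOf c s))) (tabulate-signsOf c s)

  <ᵣ⇒nested' : ∀ c s d t → SLt (elt' c s) (elt' d t) → NestedLt c s d t
  <ᵣ⇒nested' c s d t X<Y = lexVec⇒nested c s d t
    (subst₂ LexVec (tabulate-signs-elt' c s) (tabulate-signs-elt' d t)
      (lexLt⇒lexVec _ _ (<⇒lexLt (elt' c s) (elt' d t) (subset-F (signsOf c s)) (subset-F (signsOf d t)) X<Y)))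

  nested⇒<ᵣ' : ∀ c s d t → NestedLt c s d t → SLt (elt' c s) (elt' d t)
  nested⇒<ᵣ' c s d t lt = lexLt⇒< (elt' c s) (elt' d t) (subset-F (signsOf c s)) (subset-F (signsOf d t))
    (lexVec⇒lexLt _ _ (subst₂ LexVec (sym (tabulate-signs-elt' c s)) (sym (tabulate-signs-elt' d t))
      (nested⇒lexVec c s d t lt)))

  regular : Regular (step L)
  regular = record
    { k₀              = pred2^ k₀
    ; cls             = cls'
    ; sgn             = sgn'
    ; elt             = elt'
    ; _≟_             = VecP.≡-dec Bool._≟_
    ; elt-F           = λ c s → subset-F (signsOf c s)
    ; cls-elt         = cls'-elt'
    ; sgn-elt         = sgn'-elt'
    ; elt-cls-sgn     = elt'-cls'-sgn'
    ; F⁻⇒minus        = F⁻⇒minus'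
    ; elt-F⁻          = elt'-F⁻
    ; F⁺⇒plus         = F⁺⇒plus'
    ; elt-F⁺          = elt'-F⁺
    ; ≡ᵣ⇒cls          = ≡ᵣ⇒cls'
    ; cls⇒≡ᵣ          = cls'⇒≡ᵣ
    ; <ᵣ⇒nested       = <ᵣ⇒nested'
    ; nested⇒<ᵣ       = nested⇒<ᵣ'
    ; elems-cover     = λ X _ → ∈⇒lookup (allVecs-complete _ X)
    ; elems-injective = unique⇒lookup-injective (allVecs-unique _)
    }

-- Level 2 is regular.  For i : Fin n, class i consists of the pairs
-- (partner i, i+1) of sign - and (i+1, partner i) of sign +, where
-- partner i = 2n-(i+1)+1 > n ≥ i+1.

clampFin : ℕ → (k : ℕ) → Fin (suc k)
clampFin zero    k       = Fin.zero
clampFin (suc x) zero    = Fin.zero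
clampFin (suc x) (suc k) = Fin.suc (clampFin x k)

clampFin-toℕ : ∀ {k} (i : Fin (suc k)) → clampFin (toℕ i) k ≡ i
clampFin-toℕ Fin.zero              = refl
clampFin-toℕ {suc k} (Fin.suc i)   = cong Fin.suc (clampFin-toℕ i)

plusIf : ∀ {P : Set} → Dec P → Sign
plusIf (yes _) = plus
plusIf (no  _) = minus

plusIf-yes : ∀ {P : Set} (p? : Dec P) → P → plusIf p? ≡ plus
plusIf-yes (yes _) _ = refl
plusIf-yes (no ¬p) p = ⊥-elim (¬p p)

plusIf-no : ∀ {P : Set} (p? : Dec P) → ¬ P → plusIf p? ≡ minus
plusIf-no (yes p) ¬p = ⊥-elim (¬p p)
plusIf-no (no _)  _  = refl

module LevelTwo (n₀ : ℕ) where
  n : ℕ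
  n = suc n₀
  open Level2 n

  partner : ℕ → ℕ
  partner i = 2 * n ∸ suc i + 1

  partner≡ : ∀ {i} → i ℕ.< n → partner i ≡ n + (n ∸ i)
  partner≡ {i} i<n = begin
    2 * n ∸ suc i + 1        ≡⟨ cong (_+ 1) (ℕP.+-∸-assoc n {n + 0} {suc i} (ℕP.≤-trans i<n (ℕP.m≤m+n n 0))) ⟩
    n + (n + 0 ∸ suc i) + 1  ≡⟨ ℕP.+-assoc n _ 1 ⟩
    n + (n + 0 ∸ suc i + 1)  ≡⟨ cong (λ m → n + (m ∸ suc i + 1)) (ℕP.+-identityʳ n) ⟩
    n + (n ∸ suc i + 1)      ≡⟨ cong (n +_) (ℕP.+-comm (n ∸ suc i) 1) ⟩
    n + (1 + (n ∸ suc i))    ≡⟨ cong (n +_) (ℕP.+-∸-assoc 1 i<n) ⟨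
    n + (n ∸ i)              ∎
    where open ≡-Reasoning

  suc<partner : ∀ {i j} → i ℕ.< n → j ℕ.< n → suc j ℕ.< partner i
  suc<partner {i} {j} i<n j<n rewrite partner≡ i<n = ℕP.≤-<-trans j<n (ℕP.m<m+n n (ℕP.m<n⇒0<n∸m i<n))

  partner-decreasing : ∀ {i j} → i ℕ.< j → j ℕ.< n → partner j ℕ.< partner i
  partner-decreasing {i} {j} i<j j<n rewrite partner≡ (ℕP.<-trans i<j j<n) | partner≡ j<n =
    ℕP.+-monoʳ-< n (ℕP.∸-monoʳ-< i<j (ℕP.<⇒≤ j<n))

  partner≤2n : ∀ {i} → i ℕ.< n → partner i ≤ 2 * n
  partner≤2n {i} i<n rewrite partner≡ i<n | ℕP.+-identityʳ n = ℕP.+-monoʳ-≤ n (ℕP.m∸n≤m n i)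

  i<n : ∀ (i : Fin n) → toℕ i ℕ.< n
  i<n = FinP.toℕ<n

  elt₂ : Fin n → Sign → Car2
  elt₂ i minus = lowPair (suc (toℕ i))
  elt₂ i plus  = highPair (suc (toℕ i))

  cls₂ : Car2 → Fin n
  cls₂ (a , b) = clampFin (pred (a ⊓ b)) n₀

  sgn₂ : Car2 → Sign
  sgn₂ (a , b) = plusIf (a ℕ.<? b)

  InF₂ : Car2 → Set
  InF₂ A = InF2⁻ A ⊎ InF2⁺ A

  cls₂-elt₂ : ∀ i s → cls₂ (elt₂ i s) ≡ i
  cls₂-elt₂ i minus rewrite ℕP.m≥n⇒m⊓n≡n (ℕP.<⇒≤ (suc<partner (i<n i) (i<n i))) = clampFin-toℕ i
  cls₂-elt₂ i plus  rewrite ℕP.m≤n⇒m⊓n≡m (ℕP.<⇒≤ (suc<partner (i<n i) (i<n i))) = clampFin-toℕ i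

  sgn₂-elt₂ : ∀ i s → sgn₂ (elt₂ i s) ≡ s
  sgn₂-elt₂ i minus = plusIf-no  (_ ℕ.<? _) (ℕP.<-asym (suc<partner (i<n i) (i<n i)))
  sgn₂-elt₂ i plus  = plusIf-yes (_ ℕ.<? _) (suc<partner (i<n i) (i<n i))

  elt₂-F : ∀ i s → InF₂ (elt₂ i s)
  elt₂-F i minus = inj₁ (suc (toℕ i) , s≤s z≤n , i<n i , refl)
  elt₂-F i plus  = inj₂ (suc (toℕ i) , s≤s z≤n , i<n i , refl)

  low≡elt₂ : ∀ {i} (le : suc i ≤ n) → lowPair (suc i) ≡ elt₂ (Fin.fromℕ< le) minus
  low≡elt₂ le = cong (λ z → lowPair (suc z)) (sym (FinP.toℕ-fromℕ< le))

  high≡elt₂ : ∀ {i} (le : suc i ≤ n) → highPair (suc i) ≡ elt₂ (Fin.fromℕ< le) plus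
  high≡elt₂ le = cong (λ z → highPair (suc z)) (sym (FinP.toℕ-fromℕ< le))

  F₂⇒elt₂ : ∀ x → InF₂ x → Σ (Fin n) λ i → Σ Sign λ s → x ≡ elt₂ i s
  F₂⇒elt₂ x (inj₁ (suc i , _ , le , refl)) = Fin.fromℕ< le , minus , low≡elt₂ le
  F₂⇒elt₂ x (inj₂ (suc i , _ , le , refl)) = Fin.fromℕ< le , plus , high≡elt₂ le

  elt₂-cls₂-sgn₂ : ∀ x → InF₂ x → elt₂ (cls₂ x) (sgn₂ x) ≡ x
  elt₂-cls₂-sgn₂ x fx with F₂⇒elt₂ x fx
  ... | i , s , refl = cong₂ elt₂ (cls₂-elt₂ i s) (sgn₂-elt₂ i s)

  F2⁻⇒minus : ∀ x → InF2⁻ x → InF₂ x × sgn₂ x ≡ minus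
  F2⁻⇒minus x x⁻@(suc i , _ , le , refl) = inj₁ x⁻ , trans (cong sgn₂ (low≡elt₂ le)) (sgn₂-elt₂ _ minus)

  F2⁺⇒plus : ∀ x → InF2⁺ x → InF₂ x × sgn₂ x ≡ plus
  F2⁺⇒plus x x⁺@(suc i , _ , le , refl) = inj₂ x⁺ , trans (cong sgn₂ (high≡elt₂ le)) (sgn₂-elt₂ _ plus)

  cls₂-low : ∀ {i} (le : suc i ≤ n) → cls₂ (lowPair (suc i)) ≡ Fin.fromℕ< le
  cls₂-low le = trans (cong cls₂ (low≡elt₂ le)) (cls₂-elt₂ (Fin.fromℕ< le) minus)

  cls₂-high : ∀ {i} (le : suc i ≤ n) → cls₂ (highPair (suc i)) ≡ Fin.fromℕ< le
  cls₂-high le = trans (cong cls₂ (high≡elt₂ le)) (cls₂-elt₂ (Fin.fromℕ< le) plus)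

  ≡₂⇒cls₂ : ∀ x y → InF₂ x → Eq2 x y → InF₂ y × cls₂ x ≡ cls₂ y
  ≡₂⇒cls₂ x y fx (inj₁ refl) = fx , refl
  ≡₂⇒cls₂ x y fx (inj₂ (inj₁ (suc i , o , le , refl , refl))) =
    inj₂ (suc i , o , le , refl) , trans (cls₂-low le) (sym (cls₂-high le))
  ≡₂⇒cls₂ x y fx (inj₂ (inj₂ (suc i , o , le , refl , refl))) =
    inj₁ (suc i , o , le , refl) , trans (cls₂-high le) (sym (cls₂-low le))

  cls₂⇒≡₂ : ∀ x y → InF₂ x → InF₂ y → cls₂ x ≡ cls₂ y → Eq2 x y
  cls₂⇒≡₂ x y fx fy e with F₂⇒elt₂ x fx | F₂⇒elt₂ y fy
  ... | i , s , refl | j , t , refl = same-class s t (trans (sym (cls₂-elt₂ i s)) (trans e (cls₂-elt₂ j t)))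
    where
    same-class : ∀ s t → i ≡ j → Eq2 (elt₂ i s) (elt₂ j t)
    same-class minus minus refl = inj₁ refl
    same-class plus  plus  refl = inj₁ refl
    same-class minus plus  refl = inj₂ (inj₁ (suc (toℕ i) , s≤s z≤n , i<n i , refl , refl))
    same-class plus  minus refl = inj₂ (inj₂ (suc (toℕ i) , s≤s z≤n , i<n i , refl , refl))

  nested⇒<₂ : ∀ i s j t → NestedLt i s j t → Lt2 (elt₂ i s) (elt₂ j t)
  nested⇒<₂ i minus j minus (inj₁ (i<j , _))               = partner-decreasing i<j (i<n j)
  nested⇒<₂ i minus j plus  (inj₁ _)                       = suc<partner (i<n i) (i<n j)
  nested⇒<₂ i minus j plus  (inj₂ (inj₁ _))                = suc<partner (i<n i) (i<n j)
  nested⇒<₂ i minus j plus  (inj₂ (inj₂ _))                = suc<partner (i<n i) (i<n j)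
  nested⇒<₂ i plus  j plus  (inj₂ (inj₁ (j<i , _)))        = s≤s j<i
  nested⇒<₂ i plus  j t     (inj₁ (_ , ()))
  nested⇒<₂ i s     j minus (inj₂ (inj₁ (_ , ())))
  nested⇒<₂ i plus  j t     (inj₂ (inj₂ (_ , () , _)))
  nested⇒<₂ i s     j minus (inj₂ (inj₂ (_ , _ , ())))

  <₂⇒nested : ∀ i s j t → Lt2 (elt₂ i s) (elt₂ j t) → NestedLt i s j t
  <₂⇒nested i s j t lt with nested-trichotomy i s j t
  ... | inj₁ nested             = nested
  ... | inj₂ (inj₁ (refl , refl)) = ⊥-elim (ℕP.<-irrefl refl lt)
  ... | inj₂ (inj₂ nested)      = ⊥-elim (ℕP.<-asym lt (nested⇒<₂ j t i s nested))

  elems₂≡ : elems2 ≡ List.cartesianProduct (upTo (suc (2 * n))) (upTo (suc (2 * n)))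
  elems₂≡ = pairs≡cartesianProduct (upTo (suc (2 * n))) (upTo (suc (2 * n)))

  elems₂-cover : ∀ x → InF₂ x → Σ (Fin (length elems2)) λ j → List.lookup elems2 j ≡ x
  elems₂-cover x fx with F₂⇒elt₂ x fx
  ... | i , s , refl = ∈⇒lookup (subst (elt₂ i s ∈_) (sym elems₂≡)
                         (∈-cartesianProduct⁺ (∈-upTo⁺ (s≤s (first≤ s))) (∈-upTo⁺ (s≤s (second≤ s)))))
    where
    suc-i≤2n : suc (toℕ i) ≤ 2 * n
    suc-i≤2n = ℕP.≤-trans (i<n i) (ℕP.m≤m+n n _)
    first≤ : ∀ s → proj₁ (elt₂ i s) ≤ 2 * n
    first≤ minus = partner≤2n (i<n i)
    first≤ plus  = suc-i≤2n
    second≤ : ∀ s → proj₂ (elt₂ i s) ≤ 2 * n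
    second≤ minus = suc-i≤2n
    second≤ plus  = partner≤2n (i<n i)

  regular : Regular (level2 n)
  regular = record
    { k₀              = n₀
    ; cls             = cls₂
    ; sgn             = sgn₂
    ; elt             = elt₂
    ; _≟_             = ProductP.≡-dec ℕ._≟_ ℕ._≟_
    ; elt-F           = elt₂-F
    ; cls-elt         = cls₂-elt₂
    ; sgn-elt         = sgn₂-elt₂
    ; elt-cls-sgn     = elt₂-cls₂-sgn₂
    ; F⁻⇒minus        = F2⁻⇒minus
    ; elt-F⁻          = λ i → suc (toℕ i) , s≤s z≤n , i<n i , refl
    ; F⁺⇒plus         = F2⁺⇒plus
    ; elt-F⁺          = λ i → suc (toℕ i) , s≤s z≤n , i<n i , refl
    ; ≡ᵣ⇒cls          = ≡₂⇒cls₂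
    ; cls⇒≡ᵣ          = cls₂⇒≡₂
    ; <ᵣ⇒nested       = <₂⇒nested
    ; nested⇒<ᵣ       = nested⇒<₂
    ; elems-cover     = elems₂-cover
    ; elems-injective = unique⇒lookup-injective (subst Unique (sym elems₂≡)
                          (UniqueP.cartesianProduct⁺ (UniqueP.upTo⁺ (suc (2 * n))) (UniqueP.upTo⁺ (suc (2 * n)))))
    }

-- The theorem at level 2: γ(A,B) is - or + as the first coordinate of A is
-- smaller or larger than that of B, and A ≤₂ A' means a₁' ≤ a₁.
module LevelTwoTheorem (n : ℕ) where
  open Level2 n
  open Derived level1 using () renaming (_≤ᵣ_ to _≤ₛ_)

  minus≤ₛ : ∀ t → minus ≤ₛ t
  minus≤ₛ minus = inj₁ refl
  minus≤ₛ plus  = inj₂ (refl , refl)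

  theorem-level-two : ∀ A B A' B' →
    ((A ≡ A' ⊎ Lt2 A A') → (C C' : Sign) → Gamma2 A B C → Gamma2 A' B C' → C' ≤ₛ C)
    ×
    ((B ≡ B' ⊎ Lt2 B B') → (C C' : Sign) → Gamma2 A B C → Gamma2 A B' C' → C ≤ₛ C')
  theorem-level-two (a₁ , _) (b₁ , _) (a₁' , _) (b₁' , _) = part-i , part-ii
    where
    part-i : _
    part-i _           C C' _                 (inj₁ (_ , refl))     = minus≤ₛ C
    part-i _           C C' (inj₂ (_ , refl)) (inj₂ (_ , refl))     = inj₁ refl
    part-i (inj₁ refl) C C' (inj₁ (a<b , _))  (inj₂ (b<a' , _))     = ⊥-elim (ℕP.<-asym a<b b<a')
    part-i (inj₂ a'<a) C C' (inj₁ (a<b , _))  (inj₂ (b<a' , _))     =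
      ⊥-elim (ℕP.<-asym a<b (ℕP.<-trans b<a' a'<a))
    part-ii : _
    part-ii _           C C' (inj₁ (_ , refl)) _                    = minus≤ₛ C'
    part-ii _           C C' (inj₂ (_ , refl)) (inj₂ (_ , refl))    = inj₁ refl
    part-ii (inj₁ refl) C C' (inj₂ (b<a , _))  (inj₁ (a<b' , _))    = ⊥-elim (ℕP.<-asym b<a a<b')
    part-ii (inj₂ b'<b) C C' (inj₂ (b<a , _))  (inj₁ (a<b' , _))    =
      ⊥-elim (ℕP.<-asym b<a (ℕP.<-trans a<b' b'<b))

regular : ∀ n k → 1 ≤ n → Regular (lvl n (suc (suc k)))
regular (suc n₀) zero    _   = LevelTwo.regular n₀
regular n        (suc k) 1≤n = NextLevel.regular (lvl n (suc (suc k))) (regular n k 1≤n)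

lemma3p3 : (n r : ℕ) → 1 ≤ n → 2 ≤ r →
    (A B A' B' : Car n r) →
    F n r A → F n r B → F n r A' → F n r B' → A ≢ B →
    ((A' ≢ B) → Le n r A A' →
      (C C' : Car n (pred r)) → Gamma n r A B C → Gamma n r A' B C' →
      Le n (pred r) C' C)
    ×
    ((A ≢ B') → Le n r B B' →
      (C C' : Car n (pred r)) → Gamma n r A B C → Gamma n r A B' C' →
      Le n (pred r) C C')
lemma3p3 n (suc zero) _ (s≤s ())
lemma3p3 n (suc (suc zero)) _ _ A B A' B' _ _ _ _ _ =
  (λ _ → proj₁ parts) , (λ _ → proj₂ parts)
  where parts = LevelTwoTheorem.theorem-level-two n A B A' B'
lemma3p3 n (suc (suc (suc k))) 1≤n _ A B A' B' fA fB fA' fB' _ =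
  (λ _ → proj₁ parts) , (λ _ → proj₂ parts)
  where parts = SignFunctions.theorem-above-regular (lvl n (suc (suc k))) (regular n k 1≤n)
                  A B A' B' fA fB fA' fB'
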